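{- Let $\mathcal{L}$ be a higgledy-piggledy line set of $\mathrm{PG}(N,q)$, and suppose that a hyperplane $H$ contains $t$ lines of $\mathcal{L}$. Then $|\mathcal{L}|\geq N + t - \left\lfloor\frac{N-1}{q}\right\rfloor$.
   Context: $\mathrm{PG}(N,q)$ is the $N$-dimensional projective space over $\mathbb{F}_q$. A cutting blocking set of $\mathrm{PG}(N,q)$ is a point set $S$ such that for every hyperplane $H$, $S\cap H$ spans $H$. A set of lines of $\mathrm{PG}(N,q)$ is a higgledy-piggledy line set (is in higgledy-piggledy arrangement) if the union of their point sets is a cutting blocking set. -}

module Defs where

open import Level using (0ℓ)
open import Algebra.Bundles using (CommutativeRing)
open import Data.Nat using (ℕ; zero; suc)
open import Data.Fin using (Fin; zero; suc)
open import Data.Product using (Σ; ∃; ∃-syntax; _×_; _,_)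
open import Relation.Nullary using (¬_)
open import Relation.Binary.Definitions using (Decidable)
open import Relation.Binary.PropositionalEquality using (_≡_)

record FiniteField (q : ℕ) : Set₁ where
  field
    commRing : CommutativeRing 0ℓ 0ℓ
  open CommutativeRing commRing public
  field
    0≉1            : ¬ (0# ≈ 1#)
    inverse        : ∀ x → ¬ (x ≈ 0#) → ∃[ y ] (x * y ≈ 1#)
    _≟_            : Decidable _≈_
    enum           : Fin q → Carrier
    enum-complete  : ∀ x → ∃[ i ] (x ≈ enum i)
    enum-injective : ∀ i j → enum i ≈ enum j → i ≡ j

-- Projective geometry PG(N,q) over the field F, modelled in the vector space
-- F^(N+1): points are nonzero vectors (up to scalars), lines are 2-dimensional
-- subspaces, hyperplanes are kernels of nonzero linear functionals.
module PG {q : ℕ} (F : FiniteField q) (N : ℕ) where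
  open FiniteField F using (Carrier; _≈_; _+_; _*_; 0#)

  Vector : Set
  Vector = Fin (suc N) → Carrier

  ∑ : ∀ {k} → (Fin k → Carrier) → Carrier
  ∑ {zero}  f = 0#
  ∑ {suc k} f = f zero + ∑ (λ i → f (suc i))

  IsZero : Vector → Set
  IsZero v = ∀ i → v i ≈ 0#

  ⟨_,_⟩ : Vector → Vector → Carrier
  ⟨ a , x ⟩ = ∑ (λ i → a i * x i)

  InSpan : (Vector → Set) → Vector → Set
  InSpan P w = ∃[ k ] Σ (Fin k → Vector) λ xs → Σ (Fin k → Carrier) λ c →
                 (∀ j → P (xs j)) × (∀ i → w i ≈ ∑ (λ j → c j * xs j i))

  record Line : Set where
    field
      u v : Vector
      independent : ∀ a b → (∀ i → a * u i + b * v i ≈ 0#) → (a ≈ 0#) × (b ≈ 0#)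

  OnLine : Line → Vector → Set
  OnLine ℓ x = ¬ IsZero x × ∃[ a ] ∃[ b ] (∀ i → x i ≈ a * Line.u ℓ i + b * Line.v ℓ i)

  SameLine : Line → Line → Set
  SameLine ℓ ℓ' = ∀ x → (OnLine ℓ x → OnLine ℓ' x) × (OnLine ℓ' x → OnLine ℓ x)

  IsHyperplane : Vector → Set
  IsHyperplane a = ¬ IsZero a

  InHyp : Vector → Vector → Set
  InHyp a x = ⟨ a , x ⟩ ≈ 0#

  CuttingBlockingSet : (Vector → Set) → Set
  CuttingBlockingSet S = ∀ a → IsHyperplane a →
    ∀ w → InHyp a w → InSpan (λ x → S x × InHyp a x) w

  DistinctLines : ∀ {n} → (Fin n → Line) → Set
  DistinctLines L = ∀ i j → SameLine (L i) (L j) → i ≡ j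

  PointsOf : ∀ {n} → (Fin n → Line) → Vector → Set
  PointsOf L x = ∃[ i ] OnLine (L i) x

  HigglediPiggledy : ∀ {n} → (Fin n → Line) → Set
  HigglediPiggledy L = CuttingBlockingSet (PointsOf L)

  LineInHyp : Vector → Line → Set
  LineInHyp a ℓ = ∀ x → OnLine ℓ x → InHyp a x

module Submission where

-- Let J be the lines of 𝓛 not contained in H; each meets the affine space
-- PG(N,q) ∖ H in q points. A hyperplane H′ ≠ H is spanned by its points of the
-- cutting blocking set, which cannot all lie in H ∩ H′, so H′ contains one of
-- these q|J| affine points. Fixing one of them, o, the other q|J| − 1 meet every
-- hyperplane other than H that misses o, and the polynomial method (a sum over
-- F^(N+1) of a product of fewer than (N+1)(q−1) affine forms vanishes, because
-- ∑ₓ xᵏ = 0 for k < q − 1) shows that this needs N(q − 1) points. Hence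
-- q|J| > N(q − 1), i.e. |J| ≥ N − ⌊(N−1)/q⌋, while |𝓛| ≥ t + |J|.

open import Defs
open import Data.Nat as ℕ using (ℕ; zero; suc; z≤n; s≤s)
import Data.Nat.Properties as ℕ
open import Data.Fin as Fin using (Fin; zero; suc; punchIn)
import Data.Fin.Properties as Fin
open import Data.Vec.Functional using (Vector; head; tail) renaming (_∷_ to _◂_)
open import Data.Product using (∃; ∃-syntax; ∃₂; _×_; _,_; proj₁; proj₂)
open import Data.Sum using (_⊎_; inj₁; inj₂; [_,_]′)
open import Data.Empty using (⊥; ⊥-elim)
open import Data.List as List using (List; []; _∷_; length)
open import Data.List.Relation.Unary.Any as AnyM using (Any; here; there)
open import Data.List.Relation.Unary.All as AllM using (All; []; _∷_)
import Data.List.Relation.Unary.Any.Properties as Any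
import Data.List.Relation.Unary.All.Properties as All
import Data.List.Properties as List
open import Data.List.Membership.Propositional using (_∈_)
open import Data.List.Membership.Propositional.Properties using (∈-filter⁺; ∈-allFin; ∈-lookup)
open import Data.List.Relation.Unary.Unique.Propositional using (Unique)
import Data.List.Relation.Unary.Unique.Propositional.Properties as Unique
open import Data.Maybe using (nothing)
open import Function using (_∘_)
open import Relation.Nullary using (¬_; Dec; yes; no)
open import Relation.Binary.PropositionalEquality as ≡ using (_≡_; _≢_)

-- The semiring solver knows no negation: in frame-coordinates, n stands for − H.
module RingIdentities {q : ℕ} (F : FiniteField q) where

  open FiniteField F using (commutativeSemiring)
  open import Algebra.Solver.Ring.NaturalCoefficients commutativeSemiring (λ _ _ → nothing)
  open import Algebra.Bundles using (CommutativeSemiring)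
  open CommutativeSemiring commutativeSemiring

  *-exchange : ∀ c s x → c * (s * x) ≈ s * (c * x)
  *-exchange = solve 3 (λ c s x → c :* (s :* x) := s :* (c :* x)) refl

  horner-step : ∀ a x r p pr qx →
    (a + x * p) + r * (pr + x * qx) ≈ (a + r * pr) + x * (p + r * qx)
  horner-step = solve 6 (λ a x r p pr qx →
    (a :+ x :* p) :+ r :* (pr :+ x :* qx) := (a :+ r :* pr) :+ x :* (p :+ r :* qx)) refl

  horner-quotient : ∀ a x r pr qx →
    (a + r * pr) + x * (x * qx + pr) ≈ x * (pr + x * qx) + (a + r * pr)
  horner-quotient = solve 5 (λ a x r pr qx →
    (a :+ r :* pr) :+ x :* (x :* qx :+ pr) := x :* (pr :+ x :* qx) :+ (a :+ r :* pr)) refl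

  affine-head : ∀ β x g s → β + (x * g + s) ≈ g * x + (β + s)
  affine-head = solve 4 (λ β x g s → β :+ (x :* g :+ s) := g :* x :+ (β :+ s)) refl

  expand-factor : ∀ xᵏ x g s l r →
    xᵏ * g * ((s * x + l) * r) ≈ s * ((x * xᵏ) * g * r) + xᵏ * (l * g) * r
  expand-factor = solve 6 (λ xᵏ x g s l r →
    xᵏ :* g :* ((s :* x :+ l) :* r) := s :* ((x :* xᵏ) :* g :* r) :+ xᵏ :* (l :* g) :* r) refl

  frame-coordinates : ∀ α β g h G H γ n →
    (α * G + β * H) * (γ * g) + β * (h + n * (γ * g))
      ≈ α * (G * γ) * g + β * h + β * (H + n) * (γ * g)
  frame-coordinates = solve 8 (λ α β g h G H γ n →
    (α :* G :+ β :* H) :* (γ :* g) :+ β :* (h :+ n :* (γ :* g))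
      := α :* (G :* γ) :* g :+ β :* h :+ β :* (H :+ n) :* (γ :* g)) refl

  rescale : ∀ m μ t E D → m * (μ * E + t * D) ≈ (m * μ) * E + (t * m) * D
  rescale = solve 5 (λ m μ t E D → m :* (μ :* E :+ t :* D) := (m :* μ) :* E :+ (t :* m) :* D) refl

module FieldProperties {q : ℕ} (F : FiniteField q) where

  open FiniteField F public hiding (zero)
  open import Algebra.Properties.Ring ring public
    using (x∙y⁻¹≈ε⇒x≈y; x≈y⇒x∙y⁻¹≈ε; -‿involutive; -0#≈0#; -‿distribˡ-*)
  open import Relation.Binary.Reasoning.Setoid setoid public

  x*y≈0⇒x≈0∨y≈0 : ∀ x y → x * y ≈ 0# → x ≈ 0# ⊎ y ≈ 0#
  x*y≈0⇒x≈0∨y≈0 x y xy≈0 with x ≟ 0#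
  ... | yes x≈0 = inj₁ x≈0
  ... | no x≉0 with inverse x x≉0
  ... | x⁻¹ , xx⁻¹≈1 = inj₂ (begin
    y              ≈⟨ *-identityˡ y ⟨
    1# * y         ≈⟨ *-congʳ (trans (*-comm x⁻¹ x) xx⁻¹≈1) ⟨
    (x⁻¹ * x) * y  ≈⟨ *-assoc x⁻¹ x y ⟩
    x⁻¹ * (x * y)  ≈⟨ *-congˡ xy≈0 ⟩
    x⁻¹ * 0#       ≈⟨ zeroʳ x⁻¹ ⟩
    0#             ∎)

  *-≉0 : ∀ {x y} → x ≉ 0# → y ≉ 0# → x * y ≉ 0#
  *-≉0 {x} {y} x≉0 y≉0 xy≈0 with x*y≈0⇒x≈0∨y≈0 x y xy≈0
  ... | inj₁ x≈0 = x≉0 x≈0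
  ... | inj₂ y≈0 = y≉0 y≈0

  *-cancelˡ-≈0 : ∀ {s x} → s ≉ 0# → s * x ≈ 0# → x ≈ 0#
  *-cancelˡ-≈0 {s} {x} s≉0 sx≈0 with x*y≈0⇒x≈0∨y≈0 s x sx≈0
  ... | inj₁ s≈0 = ⊥-elim (s≉0 s≈0)
  ... | inj₂ x≈0 = x≈0

  x*z≈y*z⇒z≈0 : ∀ {x y z} → x * z ≈ y * z → x ≉ y → z ≈ 0#
  x*z≈y*z⇒z≈0 {x} {y} {z} xz≈yz x≉y = *-cancelˡ-≈0 (x≉y ∘ x∙y⁻¹≈ε⇒x≈y x y) (begin
    (x - y) * z        ≈⟨ distribʳ z x (- y) ⟩
    x * z + - y * z    ≈⟨ +-congˡ (-‿distribˡ-* y z) ⟨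
    x * z + - (y * z)  ≈⟨ x≈y⇒x∙y⁻¹≈ε xz≈yz ⟩
    0#                 ∎)

  index : Carrier → Fin q
  index x = proj₁ (enum-complete x)

  enum-index : ∀ x → x ≈ enum (index x)
  enum-index x = proj₂ (enum-complete x)

  enum-index-injective : ∀ {x y} → index x ≡ index y → x ≈ y
  enum-index-injective {x} {y} eq =
    trans (enum-index x) (trans (reflexive (≡.cong enum eq)) (sym (enum-index y)))

  ≈⇒index≡ : ∀ {x y} → x ≈ y → index x ≡ index y
  ≈⇒index≡ {x} {y} x≈y = enum-injective _ _ (trans (sym (enum-index x)) (trans x≈y (enum-index y)))

  index-enum : ∀ i → index (enum i) ≡ i
  index-enum i = enum-injective _ _ (sym (enum-index (enum i)))

module Sums {q : ℕ} (F : FiniteField q) where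

  open FieldProperties F
  open import Algebra.Properties.Semiring.Sum semiring public
    using ( sum; sum-cong-≋; sum-replicate-zero; sum-remove; ∑-distrib-+; ∑-comm
          ; *-distribˡ-sum; sum-permute)
  open import Algebra.Definitions _≈_ using (Congruent₁)
  open import Data.Fin.Permutation using (permutation)

  sum-zero : ∀ {n} (f : Vector Carrier n) → (∀ i → f i ≈ 0#) → sum f ≈ 0#
  sum-zero {n} f f≈0 = trans (sum-cong-≋ f≈0) (sum-replicate-zero n)

  sum-point : ∀ {n} (f : Vector Carrier n) i → (∀ j → j ≢ i → f j ≈ 0#) → sum f ≈ f i
  sum-point {suc n} f i f≈0 = begin
    sum f                      ≈⟨ sum-remove f ⟩
    f i + sum (f ∘ punchIn i)  ≈⟨ +-congˡ (sum-zero _ (λ j → f≈0 _ (Fin.punchInᵢ≢i i j))) ⟩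
    f i + 0#                   ≈⟨ +-identityʳ (f i) ⟩
    f i                        ∎

  ∑F : (Carrier → Carrier) → Carrier
  ∑F g = sum (g ∘ enum)

  ∑F-cong : ∀ {g h} → (∀ x → g x ≈ h x) → ∑F g ≈ ∑F h
  ∑F-cong g≈h = sum-cong-≋ (g≈h ∘ enum)

  ∑F-distrib-+ : ∀ g h → ∑F (λ x → g x + h x) ≈ ∑F g + ∑F h
  ∑F-distrib-+ g h = ∑-distrib-+ (g ∘ enum) (h ∘ enum)

  ∑F-*ˡ : ∀ s g → ∑F (λ x → s * g x) ≈ s * ∑F g
  ∑F-*ˡ s g = sym (*-distribˡ-sum s (g ∘ enum))

  ∑F-zero : ∀ g → (∀ x → g x ≈ 0#) → ∑F g ≈ 0#
  ∑F-zero g g≈0 = sum-zero (g ∘ enum) (g≈0 ∘ enum)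

  ∑F-point : ∀ g → Congruent₁ g → ∀ p → (∀ x → x ≉ p → g x ≈ 0#) → ∑F g ≈ g p
  ∑F-point g g-cong p g≈0 = trans
    (sum-point (g ∘ enum) (index p)
      (λ j j≢p → g≈0 (enum j) (λ eⱼ≈p → j≢p (≡.trans (≡.sym (index-enum j)) (≈⇒index≡ eⱼ≈p)))))
    (g-cong (sym (enum-index p)))

  ∑F-bijection : ∀ (φ ψ : Carrier → Carrier) → Congruent₁ φ → Congruent₁ ψ →
                 (∀ y → φ (ψ y) ≈ y) → (∀ x → ψ (φ x) ≈ x) →
                 ∀ g → Congruent₁ g → ∑F (g ∘ φ) ≈ ∑F g
  ∑F-bijection φ ψ φ-cong ψ-cong φψ≈id ψφ≈id g g-cong = sym (begin
    ∑F g                                     ≈⟨ sum-permute (g ∘ enum) π ⟩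
    sum (λ i → g (enum (index (φ (enum i)))))  ≈⟨ sum-cong-≋ (λ i → g-cong (enum-index (φ (enum i)))) ⟨
    ∑F (g ∘ φ)                               ∎)
    where
    on-indices : ∀ (σ τ : Carrier → Carrier) → Congruent₁ σ → (∀ y → σ (τ y) ≈ y) →
                 ∀ i → index (σ (enum (index (τ (enum i))))) ≡ i
    on-indices σ τ σ-cong στ≈id i = ≡.trans
      (≈⇒index≡ (trans (σ-cong (sym (enum-index _))) (στ≈id (enum i))))
      (index-enum i)
    π = permutation (λ i → index (φ (enum i))) (λ i → index (ψ (enum i)))
          (on-indices φ ψ φ-cong φψ≈id) (on-indices ψ φ ψ-cong ψφ≈id)

  open import Data.Vec.Functional.Relation.Binary.Equality.Setoid setoid public
    using (_≋_)

  ∑V : ∀ {m} → (Vector Carrier m → Carrier) → Carrier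
  ∑V {zero}  g = g (λ ())
  ∑V {suc m} g = ∑F (λ x → ∑V (λ c → g (x ◂ c)))

  ∑V-cong : ∀ {m} {g h : Vector Carrier m → Carrier} → (∀ c → g c ≈ h c) → ∑V g ≈ ∑V h
  ∑V-cong {zero}  g≈h = g≈h (λ ())
  ∑V-cong {suc m} g≈h = ∑F-cong (λ x → ∑V-cong (λ c → g≈h (x ◂ c)))

  ∑V-distrib-+ : ∀ {m} (g h : Vector Carrier m → Carrier) → ∑V (λ c → g c + h c) ≈ ∑V g + ∑V h
  ∑V-distrib-+ {zero}  g h = refl
  ∑V-distrib-+ {suc m} g h = trans
    (∑F-cong (λ x → ∑V-distrib-+ (λ c → g (x ◂ c)) (λ c → h (x ◂ c))))
    (∑F-distrib-+ (λ x → ∑V (λ c → g (x ◂ c))) (λ x → ∑V (λ c → h (x ◂ c))))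

  ∑V-*ˡ : ∀ {m} s (g : Vector Carrier m → Carrier) → ∑V (λ c → s * g c) ≈ s * ∑V g
  ∑V-*ˡ {zero}  s g = refl
  ∑V-*ˡ {suc m} s g = trans (∑F-cong (λ x → ∑V-*ˡ s (λ c → g (x ◂ c))))
                            (∑F-*ˡ s (λ x → ∑V (λ c → g (x ◂ c))))

  ∑V-zero : ∀ {m} {g : Vector Carrier m → Carrier} → (∀ c → g c ≈ 0#) → ∑V g ≈ 0#
  ∑V-zero {zero}  g≈0 = g≈0 (λ ())
  ∑V-zero {suc m} g≈0 = ∑F-zero _ (λ x → ∑V-zero (λ c → g≈0 (x ◂ c)))

  ∑V-point : ∀ {m} (g : Vector Carrier m → Carrier) → (∀ {c d} → c ≋ d → g c ≈ g d) →
             ∀ p → (∀ c → ¬ c ≋ p → g c ≈ 0#) → ∑V g ≈ g p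
  ∑V-point {zero}  g g-cong p g≈0 = g-cong (λ ())
  ∑V-point {suc m} g g-cong p g≈0 = begin
    ∑F G                   ≈⟨ ∑F-point G G-cong (head p) G≈0 ⟩
    ∑V (λ c → g (head p ◂ c)) ≈⟨ ∑V-point _ (g-cong ∘ ◂-cong refl) (tail p)
                                   (λ c c≉tail → g≈0 _ (c≉tail ∘ (_∘ suc))) ⟩
    g (head p ◂ tail p)    ≈⟨ g-cong head◂tail≋p ⟩
    g p                    ∎
    where
    ◂-cong : ∀ {x y} {c d : Vector Carrier m} → x ≈ y → c ≋ d → (x ◂ c) ≋ (y ◂ d)
    ◂-cong x≈y c≋d zero    = x≈y
    ◂-cong x≈y c≋d (suc i) = c≋d i
    head◂tail≋p : (head p ◂ tail p) ≋ p
    head◂tail≋p zero    = refl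
    head◂tail≋p (suc i) = refl
    G : Carrier → Carrier
    G x = ∑V (λ c → g (x ◂ c))
    G-cong : ∀ {x y} → x ≈ y → G x ≈ G y
    G-cong {x} {y} x≈y = ∑V-cong {g = λ c → g (x ◂ c)} {h = λ c → g (y ◂ c)}
      (λ c → g-cong (◂-cong {c = c} x≈y (λ _ → refl)))
    G≈0 : ∀ x → x ≉ head p → G x ≈ 0#
    G≈0 x x≉p₀ = ∑V-zero (λ c → g≈0 (x ◂ c) (λ x◂c≋p → x≉p₀ (x◂c≋p zero)))

module DotProduct {q : ℕ} (F : FiniteField q) where

  open FieldProperties F
  open Sums F
  open RingIdentities F using (*-exchange)
  open import Algebra.Properties.Ring ring using (-1*x≈-x)

  infix 8 _·_
  _·_ : ∀ {m} → Vector Carrier m → Vector Carrier m → Carrier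
  c · x = sum (λ i → c i * x i)

  ·-cong : ∀ {m} {c d x y : Vector Carrier m} → c ≋ d → x ≋ y → c · x ≈ d · y
  ·-cong c≋d x≋y = sum-cong-≋ (λ i → *-cong (c≋d i) (x≋y i))

  ·-congʳ : ∀ {m} (c : Vector Carrier m) {x y} → x ≋ y → c · x ≈ c · y
  ·-congʳ c = ·-cong {c = c} (λ _ → refl)

  ·-distribʳ-+ : ∀ {m} (c x y : Vector Carrier m) → c · (λ i → x i + y i) ≈ c · x + c · y
  ·-distribʳ-+ c x y = trans (sum-cong-≋ (λ i → distribˡ (c i) (x i) (y i)))
                             (∑-distrib-+ (λ i → c i * x i) (λ i → c i * y i))

  ·-*ʳ : ∀ {m} (c x : Vector Carrier m) s → c · (λ i → s * x i) ≈ s * (c · x)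
  ·-*ʳ c x s = trans (sum-cong-≋ (λ i → *-exchange (c i) s (x i)))
                     (sym (*-distribˡ-sum s (λ i → c i * x i)))

  ·-linear : ∀ {m} (c x y : Vector Carrier m) α β →
             c · (λ i → α * x i + β * y i) ≈ α * (c · x) + β * (c · y)
  ·-linear c x y α β = trans (·-distribʳ-+ c (λ i → α * x i) (λ i → β * y i))
                             (+-cong (·-*ʳ c x α) (·-*ʳ c y β))

  ·-zeroˡ : ∀ {m} (c x : Vector Carrier m) → (∀ i → c i ≈ 0#) → c · x ≈ 0#
  ·-zeroˡ c x c≈0 = sum-zero (λ i → c i * x i) (λ i → trans (*-congʳ (c≈0 i)) (zeroˡ (x i)))

  ·-linear-combination : ∀ {m k} (c : Vector Carrier m) (κ : Vector Carrier k)
                         (xs : Fin k → Vector Carrier m) →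
                         c · (λ i → sum (λ j → κ j * xs j i)) ≈ sum (λ j → κ j * (c · xs j))
  ·-linear-combination c κ xs = begin
    sum (λ i → c i * sum (λ j → κ j * xs j i))
      ≈⟨ sum-cong-≋ (λ i → *-distribˡ-sum (c i) (λ j → κ j * xs j i)) ⟩
    sum (λ i → sum (λ j → c i * (κ j * xs j i)))
      ≈⟨ ∑-comm (λ i j → c i * (κ j * xs j i)) ⟩
    sum (λ j → sum (λ i → c i * (κ j * xs j i)))
      ≈⟨ sum-cong-≋ (λ j → ·-*ʳ c (xs j) (κ j)) ⟩
    sum (λ j → κ j * (c · xs j))
      ∎

  ·-linear-combination-≉0 : ∀ {m k} (c : Vector Carrier m) (κ : Vector Carrier k)
    (xs : Fin k → Vector Carrier m) → c · (λ i → sum (λ j → κ j * xs j i)) ≉ 0# →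
    ∃[ j ] c · xs j ≉ 0#
  ·-linear-combination-≉0 {k = k} c κ xs c·∑≉0 =
    Fin.¬∀⟶∃¬ k (λ j → c · xs j ≈ 0#) (λ j → (c · xs j) ≟ 0#) (λ c·xs≈0 → c·∑≉0 (begin
      c · (λ i → sum (λ j → κ j * xs j i))  ≈⟨ ·-linear-combination c κ xs ⟩
      sum (λ j → κ j * c · xs j)           ≈⟨ sum-zero _ (λ j → trans (*-congˡ (c·xs≈0 j)) (zeroʳ _)) ⟩
      0#                                   ∎))

  unit : ∀ {m} → Fin m → Vector Carrier m
  unit l i with i Fin.≟ l
  ... | yes _ = 1#
  ... | no _  = 0#

  ·-unit : ∀ {m} (c : Vector Carrier m) l → c · unit l ≈ c l
  ·-unit c l = trans (sum-point (λ i → c i * unit l i) l off-l) at-l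
    where
    off-l : ∀ i → i ≢ l → c i * unit l i ≈ 0#
    off-l i i≢l with i Fin.≟ l
    ... | yes i≡l = ⊥-elim (i≢l i≡l)
    ... | no _    = zeroʳ (c i)
    at-l : c l * unit l l ≈ c l
    at-l with l Fin.≟ l
    ... | yes _   = *-identityʳ (c l)
    ... | no l≢l  = ⊥-elim (l≢l ≡.refl)

  ∃-a·o≈1 : ∀ {m} (a : Vector Carrier m) → ¬ (∀ i → a i ≈ 0#) → ∃[ o ] a · o ≈ 1#
  ∃-a·o≈1 {m} a a≉0 with Fin.¬∀⟶∃¬ m (λ i → a i ≈ 0#) (λ i → a i ≟ 0#) a≉0
  ... | l , aₗ≉0 = (λ i → aₗ⁻¹ * unit l i) , (begin
    a · (λ i → aₗ⁻¹ * unit l i)  ≈⟨ ·-*ʳ a (unit l) aₗ⁻¹ ⟩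
    aₗ⁻¹ * a · unit l             ≈⟨ *-congˡ (·-unit a l) ⟩
    aₗ⁻¹ * a l                    ≈⟨ *-comm aₗ⁻¹ (a l) ⟩
    a l * aₗ⁻¹                    ≈⟨ proj₂ (inverse (a l) aₗ≉0) ⟩
    1#                            ∎)
    where aₗ⁻¹ = proj₁ (inverse (a l) aₗ≉0)

  -- For distinct hyperplanes a ≠ c, both normalised at o, the vector
  -- w = cₗ o − eₗ, for a coordinate l with cₗ ≠ aₗ, lies on c but not on a.
  distinct-hyperplanes-witness : ∀ {m} (a c o : Vector Carrier m) → a · o ≈ 1# → c · o ≈ 1# →
    ¬ c ≋ a → ∃[ w ] c · w ≈ 0# × a · w ≉ 0#
  distinct-hyperplanes-witness {m} a c o a·o≈1 c·o≈1 c≉a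
    with Fin.¬∀⟶∃¬ m (λ i → c i ≈ a i) (λ i → c i ≟ a i) c≉a
  ... | l , cₗ≉aₗ = w , (trans (w-value c c·o≈1) (-‿inverseʳ (c l))) ,
                       (cₗ≉aₗ ∘ x∙y⁻¹≈ε⇒x≈y (c l) (a l) ∘ trans (sym (w-value a a·o≈1)))
    where
    w : Vector Carrier m
    w i = c l * o i + (- 1#) * unit l i
    w-value : ∀ b → b · o ≈ 1# → b · w ≈ c l + - b l
    w-value b b·o≈1 = begin
      b · w                            ≈⟨ ·-linear b o (unit l) (c l) (- 1#) ⟩
      c l * b · o + (- 1#) * b · unit l  ≈⟨ +-cong (*-congˡ b·o≈1) (*-congˡ (·-unit b l)) ⟩
      c l * 1# + (- 1#) * b l          ≈⟨ +-cong (*-identityʳ (c l)) (-1*x≈-x (b l)) ⟩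
      c l + - b l                      ∎

module PowerSums {q′ : ℕ} (F : FiniteField (suc q′)) where

  open FieldProperties F
  open Sums F
  open RingIdentities F using (horner-step; horner-quotient)
  open import Algebra.Properties.Ring ring using (+-cancelˡ)
  open import Algebra.Properties.CommutativeSemiring.Exp commutativeSemiring public
    using (_^_; ^-distrib-*; ^-congˡ)

  others : Carrier → Fin q′ → Carrier
  others y j = enum (punchIn (index y) j)

  others-≉ : ∀ y j → others y j ≉ y
  others-≉ y j e = Fin.punchInᵢ≢i (index y) j
    (≡.trans (≡.sym (index-enum (punchIn (index y) j))) (≈⇒index≡ e))

  others-injective : ∀ y i j → others y i ≈ others y j → i ≡ j
  others-injective y i j e = Fin.punchIn-injective (index y) i j (enum-injective _ _ e)

  others-complete : ∀ {x y} → x ≉ y → ∃[ j ] others y j ≈ x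
  others-complete {x} {y} x≉y = Fin.punchOut iy≢ix , (begin
    enum (punchIn (index y) (Fin.punchOut iy≢ix))  ≡⟨ ≡.cong enum (Fin.punchIn-punchOut iy≢ix) ⟩
    enum (index x)                                 ≈⟨ enum-index x ⟨
    x                                              ∎)
    where
    iy≢ix : index y ≢ index x
    iy≢ix eq = x≉y (enum-index-injective (≡.sym eq))

  1≤q′ : 1 ℕ.≤ q′
  1≤q′ = ℕ.≤-trans (s≤s z≤n) (Fin.toℕ<n (proj₁ (others-complete {1#} {0#} (0≉1 ∘ sym))))

  eval : List Carrier → Carrier → Carrier
  eval []      x = 0#
  eval (a ∷ p) x = a + x * eval p x

  quotient : Carrier → List Carrier → List Carrier
  quotient r []          = []
  quotient r (a ∷ [])    = []
  quotient r (a ∷ b ∷ p) = eval (b ∷ p) r ∷ quotient r (b ∷ p)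

  length-quotient : ∀ r a p → length (quotient r (a ∷ p)) ≡ length p
  length-quotient r a []      = ≡.refl
  length-quotient r a (b ∷ p) = ≡.cong suc (length-quotient r b p)

  eval-quotient : ∀ r p x →
    eval p x + r * eval (quotient r p) x ≈ x * eval (quotient r p) x + eval p r
  eval-quotient r [] x = trans (+-congˡ (zeroʳ r)) (sym (+-congʳ (zeroʳ x)))
  eval-quotient r (a ∷ []) x = begin
    (a + x * 0#) + r * 0#  ≈⟨ +-cong (+-congˡ (zeroʳ x)) (zeroʳ r) ⟩
    (a + 0#) + 0#          ≈⟨ +-congʳ (+-congˡ (zeroʳ r)) ⟨
    (a + r * 0#) + 0#      ≈⟨ +-comm _ 0# ⟩
    0# + (a + r * 0#)      ≈⟨ +-congʳ (zeroʳ x) ⟨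
    x * 0# + (a + r * 0#)  ∎
  eval-quotient r (a ∷ b ∷ p) x = begin
    (a + x * P) + r * (Pr + x * Q)  ≈⟨ horner-step a x r P Pr Q ⟩
    (a + r * Pr) + x * (P + r * Q)  ≈⟨ +-congˡ (*-congˡ (eval-quotient r (b ∷ p) x)) ⟩
    (a + r * Pr) + x * (x * Q + Pr) ≈⟨ horner-quotient a x r Pr Q ⟩
    x * (Pr + x * Q) + (a + r * Pr) ∎
    where
    P = eval (b ∷ p) x
    Pr = eval (b ∷ p) r
    Q = eval (quotient r (b ∷ p)) x

  -- The quotient by x − r zero has smaller degree and vanishes at the other roots.
  many-roots⇒eval≈0 : ∀ d p → length p ℕ.≤ d → (r : Fin d → Carrier) →
    (∀ i j → r i ≈ r j → i ≡ j) → (∀ i → eval p (r i) ≈ 0#) → ∀ x → eval p x ≈ 0#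
  many-roots⇒eval≈0 d       []      _          r r-inj p[r]≈0 x = refl
  many-roots⇒eval≈0 (suc d) (a ∷ p) (s≤s |p|≤d) r r-inj p[r]≈0 x = begin
    eval (a ∷ p) x                      ≈⟨ +-identityʳ _ ⟨
    eval (a ∷ p) x + 0#                 ≈⟨ +-congˡ (trans (*-congˡ (Q≈0 x)) (zeroʳ r₀)) ⟨
    eval (a ∷ p) x + r₀ * eval Q x      ≈⟨ step x ⟩
    x * eval Q x                        ≈⟨ trans (*-congˡ (Q≈0 x)) (zeroʳ x) ⟩
    0#                                  ∎
    where
    r₀ = r zero
    Q = quotient r₀ (a ∷ p)
    step : ∀ y → eval (a ∷ p) y + r₀ * eval Q y ≈ y * eval Q y
    step y = trans (eval-quotient r₀ (a ∷ p) y)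
                   (trans (+-congˡ (p[r]≈0 zero)) (+-identityʳ _))
    Q≈0 : ∀ y → eval Q y ≈ 0#
    Q≈0 = many-roots⇒eval≈0 d Q (≡.subst (ℕ._≤ d) (≡.sym (length-quotient r₀ a p)) |p|≤d)
      (r ∘ suc) (λ i j e → Fin.suc-injective (r-inj (suc i) (suc j) e))
      (λ i → x*z≈y*z⇒z≈0
        (trans (sym (+-identityˡ _)) (trans (+-congʳ (sym (p[r]≈0 (suc i)))) (step (r (suc i)))))
        (λ r₀≈rᵢ → Fin.0≢1+n (r-inj zero (suc i) r₀≈rᵢ)))

  monomial : ℕ → List Carrier
  monomial zero    = 1# ∷ []
  monomial (suc k) = 0# ∷ monomial k

  eval-monomial : ∀ k x → eval (monomial k) x ≈ x ^ k
  eval-monomial zero    x = trans (+-congˡ (zeroʳ x)) (+-identityʳ 1#)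
  eval-monomial (suc k) x = trans (+-identityˡ _) (*-congˡ (eval-monomial k x))

  length-monomial : ∀ k → length (monomial k) ≡ suc k
  length-monomial zero    = ≡.refl
  length-monomial (suc k) = ≡.cong suc (length-monomial k)

  ∃-power≉1 : ∀ k → suc k ℕ.< q′ → ∃[ t ] t ≉ 0# × t ^ suc k ≉ 1#
  ∃-power≉1 k k+1<q′ with Fin.¬∀⟶∃¬ q′ (λ j → others 0# j ^ suc k ≈ 1#) (λ j → _ ≟ 1#) ¬all≈1
    where
    xᵏ⁺¹-1 : List Carrier
    xᵏ⁺¹-1 = - 1# ∷ monomial k
    eval-xᵏ⁺¹-1 : ∀ x → eval xᵏ⁺¹-1 x ≈ - 1# + x ^ suc k
    eval-xᵏ⁺¹-1 x = +-congˡ (*-congˡ (eval-monomial k x))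
    ¬all≈1 : ¬ (∀ j → others 0# j ^ suc k ≈ 1#)
    ¬all≈1 all≈1 = 0≉1 (sym (begin
      1#                   ≈⟨ -‿involutive 1# ⟨
      - (- 1#)             ≈⟨ -‿cong (+-identityʳ _) ⟨
      - (- 1# + 0#)        ≈⟨ -‿cong (+-congˡ (zeroˡ _)) ⟨
      - eval xᵏ⁺¹-1 0#     ≈⟨ -‿cong (many-roots⇒eval≈0 q′ xᵏ⁺¹-1
                                (≡.subst (ℕ._≤ q′) (≡.sym (≡.cong suc (length-monomial k))) k+1<q′)
                                (others 0#) (others-injective 0#)
                                (λ j → trans (eval-xᵏ⁺¹-1 _)
                                  (trans (+-congˡ (all≈1 j)) (-‿inverseˡ 1#))) 0#) ⟩
      - 0#                 ≈⟨ -0#≈0# ⟩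
      0#                   ∎))
  ... | j , tᵏ⁺¹≉1 = others 0# j , others-≉ 0# j , tᵏ⁺¹≉1

  -- The sum is invariant under x ↦ x + 1, which settles k = 0, and under
  -- x ↦ t x, which multiplies it by t^k ≠ 1.
  ∑F-^≈0 : ∀ k → k ℕ.< q′ → ∑F (_^ k) ≈ 0#
  ∑F-^≈0 zero _ = sym (+-cancelˡ (∑F (λ x → x)) 0# (∑F (λ _ → 1#)) (begin
    ∑F (λ x → x) + 0#             ≈⟨ +-identityʳ _ ⟩
    ∑F (λ x → x)                  ≈⟨ ∑F-bijection (_+ 1#) (_- 1#) +-congʳ +-congʳ
                                       (λ y → shift y (- 1#) 1# (-‿inverseˡ 1#))
                                       (λ x → shift x 1# (- 1#) (-‿inverseʳ 1#))
                                       (λ x → x) (λ e → e) ⟨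
    ∑F (λ x → x + 1#)             ≈⟨ ∑F-distrib-+ (λ x → x) (λ _ → 1#) ⟩
    ∑F (λ x → x) + ∑F (λ _ → 1#)  ∎))
    where
    shift : ∀ x a b → a + b ≈ 0# → (x + a) + b ≈ x
    shift x a b a+b≈0 = trans (+-assoc x a b) (trans (+-congˡ a+b≈0) (+-identityʳ x))
  ∑F-^≈0 (suc k) k+1<q′ with ∃-power≉1 k k+1<q′
  ... | t , t≉0 , tᵏ⁺¹≉1 = x*z≈y*z⇒z≈0 (begin
    1# * S                       ≈⟨ *-identityˡ S ⟩
    S                            ≈⟨ ∑F-bijection (t *_) (t⁻¹ *_) *-congˡ *-congˡ
                                      (λ y → cancel t t⁻¹ y tt⁻¹≈1)
                                      (λ x → cancel t⁻¹ t x (trans (*-comm t⁻¹ t) tt⁻¹≈1))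
                                      (_^ suc k) (^-congˡ (suc k)) ⟨
    ∑F (λ x → (t * x) ^ suc k)     ≈⟨ ∑F-cong (λ x → ^-distrib-* t x (suc k)) ⟩
    ∑F (λ x → t ^ suc k * x ^ suc k) ≈⟨ ∑F-*ˡ (t ^ suc k) (_^ suc k) ⟩
    t ^ suc k * S                  ∎) (tᵏ⁺¹≉1 ∘ sym)
    where
    S = ∑F (_^ suc k)
    t⁻¹ = proj₁ (inverse t t≉0)
    tt⁻¹≈1 = proj₂ (inverse t t≉0)
    cancel : ∀ a b x → a * b ≈ 1# → a * (b * x) ≈ x
    cancel a b x ab≈1 = trans (sym (*-assoc a b x)) (trans (*-congʳ ab≈1) (*-identityˡ x))

module AffineProducts {q′ : ℕ} (F : FiniteField (suc q′)) where

  open FieldProperties F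
  open Sums F
  open DotProduct F
  open PowerSums F
  open RingIdentities F using (affine-head; expand-factor)

  Affine : ℕ → Set
  Affine m = Carrier × Vector Carrier m

  ⟦_⟧ : ∀ {m} → Affine m → Vector Carrier m → Carrier
  ⟦ β , γ ⟧ c = β + c · γ

  ∏ : ∀ {m} → List (Affine m) → Vector Carrier m → Carrier
  ∏ []       c = 1#
  ∏ (ℓ ∷ ℓs) c = ⟦ ℓ ⟧ c * ∏ ℓs c

  ⟦⟧-split : ∀ {m} β (γ c : Vector Carrier (suc m)) →
             ⟦ β , γ ⟧ c ≈ head γ * head c + ⟦ β , tail γ ⟧ (tail c)
  ⟦⟧-split β γ c = affine-head β (head c) (head γ) (tail c · tail γ)

  ∏-≈0 : ∀ {m} (ℓs : List (Affine m)) c → Any (λ ℓ → ⟦ ℓ ⟧ c ≈ 0#) ℓs → ∏ ℓs c ≈ 0#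
  ∏-≈0 (ℓ ∷ ℓs) c (here ℓ≈0)   = trans (*-congʳ ℓ≈0) (zeroˡ _)
  ∏-≈0 (ℓ ∷ ℓs) c (there ℓs≈0) = trans (*-congˡ (∏-≈0 ℓs c ℓs≈0)) (zeroʳ _)

  ∏-≉0 : ∀ {m} (ℓs : List (Affine m)) c → All (λ ℓ → ⟦ ℓ ⟧ c ≉ 0#) ℓs → ∏ ℓs c ≉ 0#
  ∏-≉0 []       c []             = 0≉1 ∘ sym
  ∏-≉0 (ℓ ∷ ℓs) c (ℓ≉0 ∷ ℓs≉0) = *-≉0 ℓ≉0 (∏-≉0 ℓs c ℓs≉0)

  ∏-cong : ∀ {m} (ℓs : List (Affine m)) {c d} → c ≋ d → ∏ ℓs c ≈ ∏ ℓs d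
  ∏-cong []             c≋d = refl
  ∏-cong ((β , γ) ∷ ℓs) c≋d = *-cong (+-congˡ (·-cong c≋d (λ _ → refl))) (∏-cong ℓs c≋d)

  -- Expanding the factors of the form s x + l(c) one by one produces terms
  -- x^k g(c) whose x-sum vanishes when k < q′, and whose c-sum vanishes by
  -- induction on the dimension otherwise.
  module Expansion {m}
    (∑V-∏≈0 : ∀ (gs : List (Affine m)) → length gs ℕ.< m ℕ.* q′ → ∑V (∏ gs) ≈ 0#) where

    ∑V-monomial-∏≈0 : ∀ (ℓs : List (Affine (suc m))) (gs : List (Affine m)) k →
      k ℕ.+ length gs ℕ.+ length ℓs ℕ.< suc m ℕ.* q′ →
      ∑V (λ c → head c ^ k * ∏ gs (tail c) * ∏ ℓs c) ≈ 0#
    ∑V-monomial-∏≈0 [] gs k bound = begin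
      ∑F (λ x → ∑V (λ c → x ^ k * ∏ gs c * 1#)) ≈⟨ ∑F-cong (λ x → ∑V-cong {h = λ c → x ^ k * ∏ gs c}
                                                                     (λ c → *-identityʳ _)) ⟩
      ∑F (λ x → ∑V (λ c → x ^ k * ∏ gs c))      ≈⟨ ∑F-cong (λ x → ∑V-*ˡ (x ^ k) (∏ gs)) ⟩
      ∑F (λ x → x ^ k * ∑V (∏ gs))              ≈⟨ ∑F-cong (λ x → *-comm (x ^ k) (∑V (∏ gs))) ⟩
      ∑F (λ x → ∑V (∏ gs) * x ^ k)              ≈⟨ ∑F-*ˡ (∑V (∏ gs)) (_^ k) ⟩
      ∑V (∏ gs) * ∑F (_^ k)                     ≈⟨ one-factor-vanishes ⟩
      0#                                        ∎
      where
      one-factor-vanishes : ∑V (∏ gs) * ∑F (_^ k) ≈ 0#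
      one-factor-vanishes with k ℕ.<? q′
      ... | yes k<q′ = trans (*-congˡ (∑F-^≈0 k k<q′)) (zeroʳ _)
      ... | no k≮q′  = trans (*-congʳ (∑V-∏≈0 gs (ℕ.+-cancelˡ-< q′ _ _ (ℕ.≤-<-trans
                          (ℕ.+-monoˡ-≤ (length gs) (ℕ.≮⇒≥ k≮q′))
                          (≡.subst (ℕ._< suc m ℕ.* q′) (ℕ.+-identityʳ _) bound)))))
                         (zeroˡ _)
    ∑V-monomial-∏≈0 ((β , γ) ∷ ℓs) gs k bound = begin
      ∑V (λ c → head c ^ k * G c * (⟦ β , γ ⟧ c * ∏ ℓs c))
        ≈⟨ ∑V-cong (λ c → trans (*-congˡ (*-congʳ (⟦⟧-split β γ c)))
                                (expand-factor (head c ^ k) (head c) (G c) (head γ)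
                                               (⟦ ℓ′ ⟧ (tail c)) (∏ ℓs c))) ⟩
      ∑V (λ c → head γ * A c + B c)
        ≈⟨ ∑V-distrib-+ (λ c → head γ * A c) B ⟩
      ∑V (λ c → head γ * A c) + ∑V B
        ≈⟨ +-cong (trans (∑V-*ˡ (head γ) A) (*-congˡ (∑V-monomial-∏≈0 ℓs gs (suc k) A-bound)))
                  (∑V-monomial-∏≈0 ℓs (ℓ′ ∷ gs) k B-bound) ⟩
      head γ * 0# + 0#
        ≈⟨ trans (+-identityʳ _) (zeroʳ _) ⟩
      0# ∎
      where
      ℓ′ : Affine m
      ℓ′ = β , tail γ
      G A B : Vector Carrier (suc m) → Carrier
      G c = ∏ gs (tail c)
      A c = head c ^ suc k * G c * ∏ ℓs c
      B c = head c ^ k * ∏ (ℓ′ ∷ gs) (tail c) * ∏ ℓs c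
      A-bound : suc k ℕ.+ length gs ℕ.+ length ℓs ℕ.< suc m ℕ.* q′
      A-bound = ≡.subst (ℕ._< suc m ℕ.* q′) (ℕ.+-suc (k ℕ.+ length gs) (length ℓs)) bound
      B-bound : k ℕ.+ suc (length gs) ℕ.+ length ℓs ℕ.< suc m ℕ.* q′
      B-bound = ≡.subst (ℕ._< suc m ℕ.* q′)
        (≡.sym (≡.cong (ℕ._+ length ℓs) (ℕ.+-suc k (length gs)))) A-bound

  ∑V-∏≈0 : ∀ m (ℓs : List (Affine m)) → length ℓs ℕ.< m ℕ.* q′ → ∑V (∏ ℓs) ≈ 0#
  ∑V-∏≈0 zero    ℓs ()
  ∑V-∏≈0 (suc m) ℓs bound = trans
    (∑V-cong (λ c → sym (trans (*-congʳ (*-identityˡ 1#)) (*-identityˡ (∏ ℓs c)))))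
    (Expansion.∑V-monomial-∏≈0 (∑V-∏≈0 m) ℓs [] 0 bound)

module HyperplaneBlocking {q′ : ℕ} (F : FiniteField (suc q′)) where

  open FieldProperties F
  open Sums F
  open DotProduct F
  open PowerSums F
  open AffineProducts F

  -- In dual coordinates: the product of the forms c ↦ c·b and c ↦ c·o − ν
  -- (ν ≠ 1) vanishes at every c except a, so its sum over F^(N+1) is not 0,
  -- and by ∑V-∏≈0 these q′ + |bs| factors number at least (N + 1) q′.
  blocking-bound : ∀ {N} (a o : Vector Carrier (suc N)) → a · o ≈ 1# →
    (bs : List (Vector Carrier (suc N))) → All (λ b → a · b ≉ 0#) bs →
    (∀ c → c · o ≈ 1# → ¬ c ≋ a → Any (λ b → c · b ≈ 0#) bs) →
    N ℕ.* q′ ℕ.≤ length bs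
  blocking-bound {N} a o a·o≈1 bs a·bs≉0 blocks with N ℕ.* q′ ℕ.≤? length bs
  ... | yes N*q′≤|bs| = N*q′≤|bs|
  ... | no  N*q′≰|bs| = ⊥-elim (∏-≉0 ℓs a at-a (begin
    ∏ ℓs a     ≈⟨ ∑V-point (∏ ℓs) (∏-cong ℓs) a off-a ⟨
    ∑V (∏ ℓs)  ≈⟨ ∑V-∏≈0 (suc N) ℓs bound ⟩
    0#         ∎))
    where
    through-o : List (Affine (suc N))
    through-o = List.tabulate (λ j → (- others 1# j) , o)
    through-bs : List (Affine (suc N))
    through-bs = List.map (0# ,_) bs
    ℓs : List (Affine (suc N))
    ℓs = through-o List.++ through-bs

    bound : length ℓs ℕ.< suc N ℕ.* q′
    bound = ≡.subst (ℕ._< suc N ℕ.* q′)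
      (≡.sym (≡.trans (List.length-++ through-o)
                      (≡.cong₂ ℕ._+_ (List.length-tabulate _) (List.length-map _ bs))))
      (ℕ.+-monoʳ-< q′ (ℕ.≰⇒> N*q′≰|bs|))

    off-a : ∀ c → ¬ c ≋ a → ∏ ℓs c ≈ 0#
    off-a c c≉a with (c · o) ≟ 1#
    ... | yes c·o≈1 = ∏-≈0 ℓs c (Any.++⁺ʳ through-o (Any.map⁺ (AnyM.map
                        (λ c·b≈0 → trans (+-identityˡ _) c·b≈0) (blocks c c·o≈1 c≉a))))
    ... | no c·o≉1 with others-complete c·o≉1
    ... | j , νⱼ≈c·o = ∏-≈0 ℓs c (Any.++⁺ˡ (Any.tabulate⁺ j
                         (trans (+-comm _ _) (x≈y⇒x∙y⁻¹≈ε (sym νⱼ≈c·o)))))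

    at-a : All (λ ℓ → ⟦ ℓ ⟧ a ≉ 0#) ℓs
    at-a = All.++⁺ (All.tabulate⁺ (λ j factor≈0 → others-≉ 1# j
             (sym (trans (sym a·o≈1) (x∙y⁻¹≈ε⇒x≈y _ _ (trans (+-comm _ _) factor≈0))))))
           (All.map⁺ (AllM.map (λ a·b≉0 → a·b≉0 ∘ trans (sym (+-identityˡ _))) a·bs≉0))

  affine-blocking-bound : ∀ {N} → 1 ℕ.≤ N → (a : Vector Carrier (suc N)) → ¬ (∀ i → a i ≈ 0#) →
    (ps : List (Vector Carrier (suc N))) → All (λ p → a · p ≈ 1#) ps →
    (∀ c → ¬ (∀ i → c i ≈ 0#) → ∀ w → c · w ≈ 0# → a · w ≉ 0# → Any (λ p → c · p ≈ 0#) ps) →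
    N ℕ.* q′ ℕ.< length ps
  affine-blocking-bound {N} 1≤N a a≉0 ps a·ps≈1 meets = bound ps a·ps≈1 meets-normalised
    where
    meets-normalised : ∀ o → a · o ≈ 1# → ∀ c → c · o ≈ 1# → ¬ c ≋ a → Any (λ p → c · p ≈ 0#) ps
    meets-normalised o a·o≈1 c c·o≈1 c≉a =
      let w , c·w≈0 , a·w≉0 = distinct-hyperplanes-witness a c o a·o≈1 c·o≈1 c≉a
      in meets c (λ c≈0 → 0≉1 (trans (sym (·-zeroˡ c o c≈0)) c·o≈1)) w c·w≈0 a·w≉0

    bound : ∀ qs → All (λ p → a · p ≈ 1#) qs →
            (∀ o → a · o ≈ 1# → ∀ c → c · o ≈ 1# → ¬ c ≋ a → Any (λ p → c · p ≈ 0#) qs) →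
            N ℕ.* q′ ℕ.< length qs
    bound [] [] meets′ =
      let o , a·o≈1 = ∃-a·o≈1 a a≉0
      in ⊥-elim (ℕ.<⇒≱ (ℕ.*-mono-≤ 1≤N 1≤q′) (blocking-bound a o a·o≈1 [] [] (meets′ o a·o≈1)))
    bound (p ∷ qs) (a·p≈1 ∷ a·qs≈1) meets′ = s≤s (blocking-bound a p a·p≈1 qs
      (AllM.map (λ a·b≈1 a·b≈0 → 0≉1 (trans (sym a·b≈0) a·b≈1)) a·qs≈1)
      (λ c c·p≈1 c≉a → AnyM.tail (λ c·p≈0 → 0≉1 (trans (sym c·p≈0) c·p≈1))
                                 (meets′ p a·p≈1 c c·p≈1 c≉a)))

module Frames {q : ℕ} (F : FiniteField q) where

  open FieldProperties F
  open Sums F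
  open DotProduct F
  open RingIdentities F using (frame-coordinates; rescale)

  Span₂ : ∀ {m} → Vector Carrier m → Vector Carrier m → Vector Carrier m → Set
  Span₂ g h x = ∃₂ λ α β → x ≋ (λ i → α * g i + β * h i)

  Span₂-swap : ∀ {m} {g h x : Vector Carrier m} → Span₂ g h x → Span₂ h g x
  Span₂-swap (α , β , x≋αg+βh) = β , α , λ i → trans (x≋αg+βh i) (+-comm _ _)

  -- Affine coordinates, relative to the hyperplane a, on a set P of vectors
  -- (typically a line): the points of P outside a are, up to scalars, the
  -- points  origin + t direction  with t ∈ F.
  record Frame {m} (a : Vector Carrier m) (P : Vector Carrier m → Set) : Set where
    field
      origin direction : Vector Carrier m
      a·origin≈1 : a · origin ≈ 1#
      a·direction≈0 : a · direction ≈ 0#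
      coordinates : ∀ x → P x → ∃₂ λ μ t → x ≋ (λ i → μ * origin i + t * direction i)

    point : Carrier → Vector Carrier m
    point t i = origin i + t * direction i

    points : List (Vector Carrier m)
    points = List.tabulate (point ∘ enum)

    a·point≈1 : ∀ t → a · point t ≈ 1#
    a·point≈1 t = begin
      a · point t                          ≈⟨ ·-distribʳ-+ a origin (λ i → t * direction i) ⟩
      a · origin + a · (λ i → t * direction i)  ≈⟨ +-cong a·origin≈1 (·-*ʳ a direction t) ⟩
      1# + t * a · direction               ≈⟨ +-congˡ (trans (*-congˡ a·direction≈0) (zeroʳ t)) ⟩
      1# + 0#                              ≈⟨ +-identityʳ 1# ⟩
      1#                                   ∎

    length-points : length points ≡ q
    length-points = List.length-tabulate (point ∘ enum)

    points-normalised : All (λ p → a · p ≈ 1#) points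
    points-normalised = All.tabulate⁺ (a·point≈1 ∘ enum)

    -- x = μ · point (t / μ), where μ = a·x ≠ 0.
    points-meet : ∀ c x → P x → c · x ≈ 0# → a · x ≉ 0# → Any (λ p → c · p ≈ 0#) points
    points-meet c x Px c·x≈0 a·x≉0 with coordinates x Px
    ... | μ , t , x≋μo+td = Any.tabulate⁺ (index (t * μ⁻¹)) (begin
      c · point (enum (index (t * μ⁻¹)))       ≈⟨ ·-congʳ c point-cong ⟨
      c · point (t * μ⁻¹)                      ≈⟨ ·-distribʳ-+ c origin _ ⟩
      c · origin + c · (λ i → t * μ⁻¹ * direction i) ≈⟨ +-congˡ (·-*ʳ c direction _) ⟩
      c · origin + t * μ⁻¹ * c · direction     ≈⟨ +-congʳ (*-identityˡ _) ⟨
      1# * c · origin + t * μ⁻¹ * c · direction  ≈⟨ +-congʳ (*-congʳ (trans (*-comm μ⁻¹ μ) μμ⁻¹≈1)) ⟨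
      μ⁻¹ * μ * c · origin + t * μ⁻¹ * c · direction  ≈⟨ rescale μ⁻¹ μ t _ _ ⟨
      μ⁻¹ * (μ * c · origin + t * c · direction)  ≈⟨ *-congˡ (·-linear c origin direction μ t) ⟨
      μ⁻¹ * c · (λ i → μ * origin i + t * direction i)  ≈⟨ *-congˡ (·-congʳ c x≋μo+td) ⟨
      μ⁻¹ * c · x                              ≈⟨ *-congˡ c·x≈0 ⟩
      μ⁻¹ * 0#                                 ≈⟨ zeroʳ μ⁻¹ ⟩
      0#                                       ∎)
      where
      a·x≈μ : a · x ≈ μ
      a·x≈μ = begin
        a · x                                  ≈⟨ ·-congʳ a x≋μo+td ⟩
        a · (λ i → μ * origin i + t * direction i)  ≈⟨ ·-linear a origin direction μ t ⟩
        μ * a · origin + t * a · direction     ≈⟨ +-cong (*-congˡ a·origin≈1) (*-congˡ a·direction≈0) ⟩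
        μ * 1# + t * 0#                        ≈⟨ +-cong (*-identityʳ μ) (zeroʳ t) ⟩
        μ + 0#                                 ≈⟨ +-identityʳ μ ⟩
        μ                                      ∎
      μ⁻¹ = proj₁ (inverse μ (a·x≉0 ∘ trans a·x≈μ))
      μμ⁻¹≈1 = proj₂ (inverse μ (a·x≉0 ∘ trans a·x≈μ))
      point-cong : point (t * μ⁻¹) ≋ point (enum (index (t * μ⁻¹)))
      point-cong i = +-congˡ (*-congʳ (enum-index (t * μ⁻¹)))

  Frame-restrict : ∀ {m} {a} {P Q : Vector Carrier m → Set} →
                   (∀ {x} → Q x → P x) → Frame a P → Frame a Q
  Frame-restrict Q⇒P fr = record
    { origin = origin
    ; direction = direction
    ; a·origin≈1 = a·origin≈1
    ; a·direction≈0 = a·direction≈0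
    ; coordinates = λ x Qx → coordinates x (Q⇒P Qx)
    }
    where open Frame fr

  frame-from-span : ∀ {m} (a g h : Vector Carrier m) → a · g ≉ 0# → Frame a (Span₂ g h)
  frame-from-span a g h a·g≉0 = record
    { origin = e
    ; direction = d
    ; a·origin≈1 = a·e≈1
    ; a·direction≈0 = a·d≈0
    ; coordinates = coordinates
    }
    where
    G = a · g
    H = a · h
    γ = proj₁ (inverse G a·g≉0)
    Gγ≈1 = proj₂ (inverse G a·g≉0)
    e d : Vector Carrier _
    e i = γ * g i
    d i = h i + (- H) * e i
    a·e≈1 : a · e ≈ 1#
    a·e≈1 = trans (·-*ʳ a g γ) (trans (*-comm γ G) Gγ≈1)
    a·d≈0 : a · d ≈ 0#
    a·d≈0 = begin
      a · d                        ≈⟨ ·-distribʳ-+ a h (λ i → (- H) * e i) ⟩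
      H + a · (λ i → (- H) * e i)  ≈⟨ +-congˡ (·-*ʳ a e (- H)) ⟩
      H + (- H) * a · e            ≈⟨ +-congˡ (trans (*-congˡ a·e≈1) (*-identityʳ _)) ⟩
      H + - H                      ≈⟨ -‿inverseʳ H ⟩
      0#                           ∎
    coordinates : ∀ x → Span₂ g h x → ∃₂ λ μ t → x ≋ (λ i → μ * e i + t * d i)
    coordinates x (α , β , x≋αg+βh) = α * G + β * H , β , λ i → begin
      x i                                          ≈⟨ x≋αg+βh i ⟩
      α * g i + β * h i                            ≈⟨ +-congʳ (*-congʳ (*-identityʳ α)) ⟨
      α * 1# * g i + β * h i                       ≈⟨ +-congʳ (*-congʳ (*-congˡ Gγ≈1)) ⟨
      α * (G * γ) * g i + β * h i                  ≈⟨ +-identityʳ _ ⟨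
      α * (G * γ) * g i + β * h i + 0#
        ≈⟨ +-congˡ (trans (*-congʳ (trans (*-congˡ (-‿inverseʳ H)) (zeroʳ β))) (zeroˡ _)) ⟨
      α * (G * γ) * g i + β * h i + β * (H + - H) * e i
        ≈⟨ frame-coordinates α β (g i) (h i) G H γ (- H) ⟨
      (α * G + β * H) * e i + β * d i              ∎

module Geometry {q′ : ℕ} (F : FiniteField (suc q′)) (N : ℕ) where

  open FieldProperties F
  open Sums F
  open DotProduct F
  open HyperplaneBlocking F using (affine-blocking-bound)
  open Frames F
  open PG F N using (Line; OnLine; LineInHyp; PointsOf; HigglediPiggledy; IsHyperplane)
  open Line

  ∑≡sum : ∀ {k} (f : Vector Carrier k) → PG.∑ F N f ≡ sum f
  ∑≡sum {zero}  f = ≡.refl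
  ∑≡sum {suc k} f = ≡.cong (f zero +_) (∑≡sum (f ∘ suc))

  ⟨⟩≡· : ∀ a x → PG.⟨_,_⟩ F N a x ≡ a · x
  ⟨⟩≡· a x = ∑≡sum (λ i → a i * x i)

  -- Stated through the generators, so that it is decidable.
  LineNotInHyp : Vector Carrier (suc N) → Line → Set
  LineNotInHyp a ℓ = ¬ (a · u ℓ ≈ 0# × a · v ℓ ≈ 0#)

  lineNotInHyp? : ∀ a ℓ → Dec (LineNotInHyp a ℓ)
  lineNotInHyp? a ℓ with (a · u ℓ) ≟ 0# | (a · v ℓ) ≟ 0#
  ... | yes a·u≈0 | yes a·v≈0 = no (λ off → off (a·u≈0 , a·v≈0))
  ... | no a·u≉0  | _         = yes (a·u≉0 ∘ proj₁)
  ... | yes _     | no a·v≉0  = yes (a·v≉0 ∘ proj₂)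

  OnLine-≉0⇒LineNotInHyp : ∀ a ℓ x → OnLine ℓ x → a · x ≉ 0# → LineNotInHyp a ℓ
  OnLine-≉0⇒LineNotInHyp a ℓ x (_ , α , β , x≋αu+βv) a·x≉0 (a·u≈0 , a·v≈0) = a·x≉0 (begin
    a · x                         ≈⟨ ·-congʳ a x≋αu+βv ⟩
    a · (λ i → α * u ℓ i + β * v ℓ i)  ≈⟨ ·-linear a (u ℓ) (v ℓ) α β ⟩
    α * a · u ℓ + β * a · v ℓ     ≈⟨ +-cong (*-congˡ a·u≈0) (*-congˡ a·v≈0) ⟩
    α * 0# + β * 0#               ≈⟨ +-cong (zeroʳ α) (zeroʳ β) ⟩
    0# + 0#                       ≈⟨ +-identityʳ 0# ⟩
    0#                            ∎)

  u-on-line : ∀ ℓ → OnLine ℓ (u ℓ)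
  u-on-line ℓ = u≉0 , 1# , 0# , λ i → sym (trans (+-cong (*-identityˡ _) (zeroˡ _)) (+-identityʳ _))
    where
    u≉0 : ¬ (∀ i → u ℓ i ≈ 0#)
    u≉0 u≈0 = 0≉1 (sym (proj₁ (independent ℓ 1# 0# (λ i →
      trans (+-cong (trans (*-identityˡ _) (u≈0 i)) (zeroˡ _)) (+-identityʳ 0#)))))

  v-on-line : ∀ ℓ → OnLine ℓ (v ℓ)
  v-on-line ℓ = v≉0 , 0# , 1# , λ i → sym (trans (+-cong (zeroˡ _) (*-identityˡ _)) (+-identityˡ _))
    where
    v≉0 : ¬ (∀ i → v ℓ i ≈ 0#)
    v≉0 v≈0 = 0≉1 (sym (proj₂ (independent ℓ 0# 1# (λ i →
      trans (+-cong (zeroˡ _) (trans (*-identityˡ _) (v≈0 i))) (+-identityʳ 0#)))))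

  LineInHyp⇒¬LineNotInHyp : ∀ a ℓ → LineInHyp a ℓ → ¬ LineNotInHyp a ℓ
  LineInHyp⇒¬LineNotInHyp a ℓ ℓ⊆a off = off (on-a (u ℓ) (u-on-line ℓ) , on-a (v ℓ) (v-on-line ℓ))
    where
    on-a : ∀ x → OnLine ℓ x → a · x ≈ 0#
    on-a x x∈ℓ = ≡.subst (_≈ 0#) (⟨⟩≡· a x) (ℓ⊆a x x∈ℓ)

  line-frame : ∀ a ℓ → LineNotInHyp a ℓ → Frame a (OnLine ℓ)
  line-frame a ℓ off with (a · v ℓ) ≟ 0#
  ... | no a·v≉0  = Frame-restrict (Span₂-swap ∘ proj₂) (frame-from-span a (v ℓ) (u ℓ) a·v≉0)
  ... | yes a·v≈0 = Frame-restrict proj₂ (frame-from-span a (u ℓ) (v ℓ) (λ a·u≈0 → off (a·u≈0 , a·v≈0)))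

  -- w is a combination of points of S ∩ c, so one of them lies off a.
  ∃-point-off-hyperplane : ∀ {n} (L : Fin n → Line) → HigglediPiggledy L → ∀ a c → IsHyperplane c →
    ∀ w → c · w ≈ 0# → a · w ≉ 0# → ∃[ x ] PointsOf L x × c · x ≈ 0# × a · x ≉ 0#
  ∃-point-off-hyperplane L hp a c c-hyp w c·w≈0 a·w≉0 =
    let k , xs , κ , xs∈S∩c , w≈∑κxs = hp c c-hyp w (≡.subst (_≈ 0#) (≡.sym (⟨⟩≡· c w)) c·w≈0)
        w≋∑κxs = λ i → trans (w≈∑κxs i) (reflexive (∑≡sum (λ j → κ j * xs j i)))
        j , a·xⱼ≉0 = ·-linear-combination-≉0 a κ xs (a·w≉0 ∘ trans (·-congʳ a w≋∑κxs))
    in xs j , proj₁ (xs∈S∩c j) , ≡.subst (_≈ 0#) (⟨⟩≡· c (xs j)) (proj₂ (xs∈S∩c j)) , a·xⱼ≉0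

  module LinesNotInHyp {n} (L : Fin n → Line) (a : Vector Carrier (suc N)) where

    notInHyp? : ∀ j → Dec (LineNotInHyp a (L j))
    notInHyp? j = lineNotInHyp? a (L j)

    linesNotInHyp : List (Fin n)
    linesNotInHyp = List.filter notInHyp? (List.allFin n)

    linesNotInHyp-sound : All (LineNotInHyp a ∘ L) linesNotInHyp
    linesNotInHyp-sound = All.all-filter notInHyp? (List.allFin n)

    linesNotInHyp-complete : ∀ {j} → LineNotInHyp a (L j) → j ∈ linesNotInHyp
    linesNotInHyp-complete {j} = ∈-filter⁺ notInHyp? (∈-allFin j)

    linesNotInHyp-unique : Unique linesNotInHyp
    linesNotInHyp-unique = Unique.filter⁺ notInHyp? (Unique.allFin⁺ n)

    affinePoints : (js : List (Fin n)) → All (LineNotInHyp a ∘ L) js → List (Vector Carrier (suc N))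
    affinePoints []       []           = []
    affinePoints (j ∷ js) (off ∷ offs) =
      Frame.points (line-frame a (L j) off) List.++ affinePoints js offs

    length-affinePoints : ∀ js offs → length (affinePoints js offs) ≡ length js ℕ.* suc q′
    length-affinePoints []       []           = ≡.refl
    length-affinePoints (j ∷ js) (off ∷ offs) = ≡.trans
      (List.length-++ (Frame.points (line-frame a (L j) off)))
      (≡.cong₂ ℕ._+_ (Frame.length-points (line-frame a (L j) off)) (length-affinePoints js offs))

    affinePoints-normalised : ∀ js offs → All (λ p → a · p ≈ 1#) (affinePoints js offs)
    affinePoints-normalised []       []           = []
    affinePoints-normalised (j ∷ js) (off ∷ offs) =
      All.++⁺ (Frame.points-normalised (line-frame a (L j) off)) (affinePoints-normalised js offs)

    affinePoints-meet : ∀ js offs c {j} x → j ∈ js → OnLine (L j) x → c · x ≈ 0# → a · x ≉ 0# →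
                        Any (λ p → c · p ≈ 0#) (affinePoints js offs)
    affinePoints-meet (j ∷ js) (off ∷ offs) c x (here ≡.refl) x∈Lⱼ c·x≈0 a·x≉0 =
      Any.++⁺ˡ (Frame.points-meet (line-frame a (L j) off) c x x∈Lⱼ c·x≈0 a·x≉0)
    affinePoints-meet (j ∷ js) (off ∷ offs) c x (there j∈js) x∈L c·x≈0 a·x≉0 =
      Any.++⁺ʳ _ (affinePoints-meet js offs c x j∈js x∈L c·x≈0 a·x≉0)

    length-linesNotInHyp-bound : 1 ℕ.≤ N → IsHyperplane a → HigglediPiggledy L →
                                 N ℕ.* q′ ℕ.< length linesNotInHyp ℕ.* suc q′
    length-linesNotInHyp-bound 1≤N a-hyp hp =
      ≡.subst (N ℕ.* q′ ℕ.<_) (length-affinePoints linesNotInHyp linesNotInHyp-sound)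
        (affine-blocking-bound 1≤N a a-hyp points
          (affinePoints-normalised linesNotInHyp linesNotInHyp-sound) meets)
      where
      points = affinePoints linesNotInHyp linesNotInHyp-sound
      meets : ∀ c → IsHyperplane c → ∀ w → c · w ≈ 0# → a · w ≉ 0# → Any (λ p → c · p ≈ 0#) points
      meets c c-hyp w c·w≈0 a·w≉0 =
        let x , (i , x∈Lᵢ) , c·x≈0 , a·x≉0 = ∃-point-off-hyperplane L hp a c c-hyp w c·w≈0 a·w≉0
            i∈lines = linesNotInHyp-complete (OnLine-≉0⇒LineNotInHyp a (L i) x x∈Lᵢ a·x≉0)
        in affinePoints-meet linesNotInHyp linesNotInHyp-sound c x i∈lines x∈Lᵢ c·x≈0 a·x≉0

module Counting where

  open import Data.List.Relation.Unary.AllPairs using (_∷_)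
  open import Function.Definitions using (Injective)

  lookup-injective : ∀ {A : Set} {xs : List A} → Unique xs →
                     ∀ i j → List.lookup xs i ≡ List.lookup xs j → i ≡ j
  lookup-injective (_ ∷ _)       zero    zero    _  = ≡.refl
  lookup-injective (x∉xs ∷ _)    zero    (suc j) eq = ⊥-elim (AllM.lookup x∉xs (∈-lookup j) eq)
  lookup-injective (x∉xs ∷ _)    (suc i) zero    eq = ⊥-elim (AllM.lookup x∉xs (∈-lookup i) (≡.sym eq))
  lookup-injective (_ ∷ unique) (suc i) (suc j) eq = ≡.cong suc (lookup-injective unique i j eq)

  injective-disjoint⇒+length≤ : ∀ {t n} (f : Fin t → Fin n) → Injective _≡_ _≡_ f →
              (js : List (Fin n)) → Unique js → (∀ k → ¬ f k ∈ js) → t ℕ.+ length js ℕ.≤ n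
  injective-disjoint⇒+length≤ {t} f f-inj js js-unique f∉js = Fin.injective⇒≤ λ {i} {i′} eq → ≡.trans
    (≡.sym (Fin.join-splitAt t _ i))
    (≡.trans (≡.cong (Fin.join t _) (cases (Fin.splitAt t i) (Fin.splitAt t i′) eq))
             (Fin.join-splitAt t _ i′))
    where
    cases : ∀ s s′ → [ f , List.lookup js ]′ s ≡ [ f , List.lookup js ]′ s′ → s ≡ s′
    cases (inj₁ k) (inj₁ k′) eq = ≡.cong inj₁ (f-inj eq)
    cases (inj₁ k) (inj₂ l)  eq = ⊥-elim (f∉js k (≡.subst (_∈ js) (≡.sym eq) (∈-lookup l)))
    cases (inj₂ l) (inj₁ k)  eq = ⊥-elim (f∉js k (≡.subst (_∈ js) eq (∈-lookup l)))
    cases (inj₂ l) (inj₂ l′) eq = ≡.cong inj₂ (lookup-injective js-unique l l′ eq)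

module Arithmetic where

  open import Data.Nat
  open import Data.Nat.Properties
  open import Data.Nat.DivMod using (m≡m%n+[m/n]*n; m%n<n)

  -- N q′ < j q  forces  j ≥ N − ⌊(N − 1)/q⌋, as  N − 1 < (⌊(N − 1)/q⌋ + 1) q.
  N≤j+[N∸1]/q : ∀ N q′ j → 1 ≤ N → N * q′ < j * suc q′ → N ≤ j + (N ∸ 1) / suc q′
  N≤j+[N∸1]/q (suc N′) q′ j _ Nq′<jq with suc N′ ≤? j + N′ / suc q′
  ... | yes N≤j+k = N≤j+k
  ... | no N≰j+k = ⊥-elim (<-irrefl ≡.refl (begin-strict
    suc (j + k) * q   ≤⟨ *-monoˡ-≤ q (≰⇒> N≰j+k) ⟩
    N * q             ≡⟨ *-suc N q′ ⟩
    N + N * q′        <⟨ +-monoʳ-< N Nq′<jq ⟩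
    N + j * q         ≤⟨ +-monoˡ-≤ (j * q) N≤[k+1]q ⟩
    suc k * q + j * q ≡⟨ *-distribʳ-+ q (suc k) j ⟨
    (suc k + j) * q   ≡⟨ ≡.cong (λ m → suc m * q) (+-comm k j) ⟩
    suc (j + k) * q   ∎))
    where
    open ≤-Reasoning
    N = suc N′
    q = suc q′
    k = N′ / q
    N≤[k+1]q : N ≤ suc k * q
    N≤[k+1]q = ≡.subst (_< suc k * q) (≡.sym (m≡m%n+[m/n]*n N′ q)) (+-monoˡ-< (k * q) (m%n<n N′ q))

  N+t∸[N∸1]/q≤n : ∀ N q′ t n j → 1 ≤ N → N * q′ < j * suc q′ → t + j ≤ n →
                 N + t ∸ (N ∸ 1) / suc q′ ≤ n
  N+t∸[N∸1]/q≤n N q′ t n j 1≤N Nq′<jq t+j≤n = m≤n+o⇒m∸n≤o (N + t) k (begin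
    N + t        ≤⟨ +-monoˡ-≤ t (N≤j+[N∸1]/q N q′ j 1≤N Nq′<jq) ⟩
    j + k + t    ≡⟨ ≡.cong (_+ t) (+-comm j k) ⟩
    k + j + t    ≡⟨ +-assoc k j t ⟩
    k + (j + t)  ≡⟨ ≡.cong (k +_) (+-comm j t) ⟩
    k + (t + j)  ≤⟨ +-monoʳ-≤ k t+j≤n ⟩
    k + n        ∎)
    where
    open ≤-Reasoning
    k = (N ∸ 1) / suc q′

no-field-of-size-0 : ¬ FiniteField 0
no-field-of-size-0 F with FiniteField.enum-complete F (FiniteField.0# F)
... | () , _

open import Data.Nat using (ℕ; _+_; _∸_; _≤_; _/_; NonZero)
open import Data.Fin using (Fin)
open import Data.Product using (_×_)
open import Function.Definitions using (Injective)
open import Relation.Binary.PropositionalEquality using (_≡_)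

lemma3p11 : ∀ {q : ℕ} .{{_ : NonZero q}} (F : FiniteField q) (N : ℕ) → 1 ≤ N →
    (n : ℕ) (L : Fin n → PG.Line F N) → PG.DistinctLines F N L →
    PG.HigglediPiggledy F N L →
    (a : PG.Vector F N) → PG.IsHyperplane F N a →
    (t : ℕ) (f : Fin t → Fin n) → Injective _≡_ _≡_ f →
    (∀ k → PG.LineInHyp F N a (L (f k))) →
    N + t ∸ (N ∸ 1) / q ≤ n
lemma3p11 {zero} F _ _ _ _ _ _ _ _ _ _ _ _ = ⊥-elim (no-field-of-size-0 F)
lemma3p11 {suc q′} F N 1≤N n L _ hp a a-hyp t f f-inj f⊆a =
  Arithmetic.N+t∸[N∸1]/q≤n N q′ t n (length linesNotInHyp) 1≤N
    (length-linesNotInHyp-bound 1≤N a-hyp hp)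
    (Counting.injective-disjoint⇒+length≤ f f-inj linesNotInHyp linesNotInHyp-unique
      (λ k fk∈lines → LineInHyp⇒¬LineNotInHyp a (L (f k)) (f⊆a k)
                        (AllM.lookup linesNotInHyp-sound fk∈lines)))
  where
  open Geometry F N
  open LinesNotInHyp L a
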